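{- Let $G\le\mathcal{S}_v$ be a permutation group acting on $\mathcal{S}_{v,t}$ by $g(s_1,\dots,s_t)=(g(s_1),\dots,g(s_t))$, and let $s\in\mathcal{S}_{v,t}$. Then the number of permutations in $G$ that cover $s$ equals $|\mathrm{Asc}(s)|\,|\mathrm{Stab}(s)|$, where $\mathrm{Stab}(s)=\{g\in G: gs=s\}$ and $\mathrm{Asc}(s)=\{x\in \mathrm{Orb}(s): x_1<x_2<\dots<x_t\}$ with $\mathrm{Orb}(s)=\{gs: g\in G\}$.
   Context: $[v]=\{0,\dots,v-1\}$, $\mathcal{S}_v$ is the symmetric group on $[v]$, and $\mathcal{S}_{v,t}$ is the set of ordered sequences of $t$ distinct elements of $[v]$. A permutation $\pi$ covers $s\in\mathcal{S}_{v,t}$ if $\pi^{ -1}(s_i)<\pi^{ -1}(s_{i+1})$ for all $i\in\{1,\dots,t-1\}$. -}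

module Defs where

open import Data.Nat.Base using (ℕ)
open import Data.Fin.Base using (Fin; _<_)
open import Data.Fin.Properties using (_<?_; _≟_)
open import Data.Fin.Permutation using (Permutation′; _⟨$⟩ʳ_; _⟨$⟩ˡ_; id; flip; _∘ₚ_)
open import Data.Vec.Base as Vec using (Vec)
open import Data.Vec.Properties using (≡-dec)
open import Data.Vec.Relation.Unary.Linked using (Linked; linked?)
open import Data.Vec.Relation.Unary.Unique.Propositional using (Unique)
open import Data.List.Base as List using (List; length; filter; deduplicate)
open import Data.List.Relation.Unary.Any using (Any)
open import Data.List.Relation.Unary.All using (All)
open import Data.List.Relation.Unary.AllPairs using (AllPairs)
open import Data.Product.Base using (Σ)
open import Relation.Binary.PropositionalEquality using (_≡_)
open import Relation.Nullary using (¬_; Dec)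

_≈ₚ_ : ∀ {v} → Permutation′ v → Permutation′ v → Set
π ≈ₚ σ = ∀ i → π ⟨$⟩ʳ i ≡ σ ⟨$⟩ʳ i

_∈ₚ_ : ∀ {v} → Permutation′ v → List (Permutation′ v) → Set
π ∈ₚ G = Any (λ g → g ≈ₚ π) G

record IsPermGroup {v : ℕ} (G : List (Permutation′ v)) : Set where
  field
    distinct : AllPairs (λ g h → ¬ (g ≈ₚ h)) G
    has-id   : id ∈ₚ G
    closed-∘ : All (λ g → All (λ h → (g ∘ₚ h) ∈ₚ G) G) G
    closed-⁻¹ : All (λ g → flip g ∈ₚ G) G

SeqDistinct : ℕ → ℕ → Set
SeqDistinct v t = Σ (Vec (Fin v) t) Unique

act : ∀ {v t} → Permutation′ v → Vec (Fin v) t → Vec (Fin v) t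
act g s = Vec.map (g ⟨$⟩ʳ_) s

Increasing : ∀ {v t} → Vec (Fin v) t → Set
Increasing x = Linked _<_ x

increasing? : ∀ {v t} (x : Vec (Fin v) t) → Dec (Increasing x)
increasing? x = linked? _<?_ x

-- π covers s iff π⁻¹(s_i) < π⁻¹(s_{i+1}) for all consecutive i.
Covers : ∀ {v t} → Permutation′ v → Vec (Fin v) t → Set
Covers π s = Increasing (Vec.map (π ⟨$⟩ˡ_) s)

covers? : ∀ {v t} (π : Permutation′ v) (s : Vec (Fin v) t) → Dec (Covers π s)
covers? π s = increasing? (Vec.map (π ⟨$⟩ˡ_) s)

numCovering : ∀ {v t} → List (Permutation′ v) → Vec (Fin v) t → ℕ
numCovering G s = length (filter (λ g → covers? g s) G)

Stab : ∀ {v t} → List (Permutation′ v) → Vec (Fin v) t → List (Permutation′ v)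
Stab G s = filter (λ g → ≡-dec _≟_ (act g s) s) G

Orb : ∀ {v t} → List (Permutation′ v) → Vec (Fin v) t → List (Vec (Fin v) t)
Orb G s = deduplicate (≡-dec _≟_) (List.map (λ g → act g s) G)

Asc : ∀ {v t} → List (Permutation′ v) → Vec (Fin v) t → List (Vec (Fin v) t)
Asc G s = filter increasing? (Orb G s)

-- A permutation π covers s exactly when π⁻¹ s is increasing, and inversion permutes G, so the
-- number of covering elements of G is the number of g ∈ G with g s increasing. Grouping these g
-- by the point x = g s of Asc(s): if x = h s with h ∈ G, then g s = h s iff h⁻¹ g ∈ Stab(s), so
-- the fibre over x is the coset h Stab(s), and each of the |Asc(s)| fibres has |Stab(s)| elements.
module Submission where

open import Defs
open import Level using (Level)
open import Data.Nat.Base using (ℕ; suc; _+_; _*_)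
open import Data.Nat.Properties using (+-assoc; +-comm; *-zeroʳ)
open import Data.Fin.Base using (Fin)
open import Data.Fin.Properties using (_≟_)
open import Data.Fin.Permutation using (Permutation′; _⟨$⟩ʳ_; _⟨$⟩ˡ_; flip; _∘ₚ_; inverseˡ; inverseʳ)
open import Data.List.Base using (List; []; _∷_; _++_; length; map; filter; deduplicate)
open import Data.List.Properties using (filter-≐)
open import Data.List.Membership.Propositional using (_∈_; _∉_)
open import Data.List.Membership.Propositional.Properties
  using (∈-map⁺; ∈-map⁻; ∈-filter⁺; ∈-filter⁻; ∈-deduplicate⁺; ∈-deduplicate⁻)
import Data.List.Membership.Setoid as SetoidMembership
import Data.List.Membership.Setoid.Properties as SetoidMembershipProperties
open import Data.List.Relation.Unary.All as All using (All)
open import Data.List.Relation.Unary.Any as Any using (Any; here; there)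
open import Data.List.Relation.Unary.AllPairs as AllPairs using (_∷_)
open import Data.List.Relation.Unary.Unique.Propositional using (Unique)
import Data.List.Relation.Unary.Unique.Propositional.Properties as UniqueProperties
open import Data.List.Relation.Unary.Unique.DecPropositional.Properties using (deduplicate-!)
import Data.List.Relation.Unary.Unique.Setoid as SetoidUnique
import Data.List.Relation.Unary.Unique.Setoid.Properties as SetoidUniqueProperties
import Data.List.Relation.Binary.Subset.Setoid as SetoidSubset
import Data.List.Relation.Binary.Permutation.Setoid as SetoidPermutation
import Data.List.Relation.Binary.Permutation.Setoid.Properties as SetoidPermutationProperties
open import Data.Product.Base using (_,_; proj₁; proj₂)
open import Data.Vec.Base as Vec using (Vec)
open import Data.Vec.Properties using (≡-dec; map-cong; map-∘; map-id)
open import Function.Base using (_∘_)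
open import Function.Definitions using (Congruent)
open import Relation.Binary.Bundles using (Setoid)
import Relation.Binary.Construct.On as On
open import Relation.Binary.Definitions using (DecidableEquality; _Respects_)
open import Relation.Binary.PropositionalEquality
  using (_≡_; refl; sym; trans; cong; cong₂; subst; _→-setoid_; module ≡-Reasoning)
open import Relation.Nullary using (Dec; yes; no; contradiction)
open import Relation.Unary using (Pred; Decidable; _≐_)

private
  variable
    a p ℓ : Level
    A B : Set a

∑ : List A → (A → ℕ) → ℕ
∑ []       F = 0
∑ (x ∷ xs) F = F x + ∑ xs F

indicator : ∀ {P : Set p} → Dec P → ℕ
indicator (yes _) = 1
indicator (no _)  = 0

length-filter≡∑-indicator : ∀ {P : Pred A p} (P? : Decidable P) xs →
                            length (filter P? xs) ≡ ∑ xs (indicator ∘ P?)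
length-filter≡∑-indicator P? []       = refl
length-filter≡∑-indicator P? (x ∷ xs) with P? x
... | yes _ = cong suc (length-filter≡∑-indicator P? xs)
... | no _  = length-filter≡∑-indicator P? xs

∑-cong-∈ : ∀ xs {F H : A → ℕ} → (∀ {x} → x ∈ xs → F x ≡ H x) → ∑ xs F ≡ ∑ xs H
∑-cong-∈ []       F≡H = refl
∑-cong-∈ (x ∷ xs) F≡H = cong₂ _+_ (F≡H (here refl)) (∑-cong-∈ xs (F≡H ∘ there))

∑-const : ∀ (xs : List A) c → ∑ xs (λ _ → c) ≡ length xs * c
∑-const []       c = refl
∑-const (x ∷ xs) c = cong (c +_) (∑-const xs c)

∑-+ : ∀ xs (F H : A → ℕ) → ∑ xs (λ x → F x + H x) ≡ ∑ xs F + ∑ xs H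
∑-+ []       F H = refl
∑-+ (x ∷ xs) F H = begin
  F x + H x + ∑ xs (λ x → F x + H x) ≡⟨ cong (F x + H x +_) (∑-+ xs F H) ⟩
  F x + H x + (∑ xs F + ∑ xs H)      ≡⟨ +-assoc (F x) (H x) _ ⟩
  F x + (H x + (∑ xs F + ∑ xs H))    ≡⟨ cong (F x +_) (+-assoc (H x) (∑ xs F) _) ⟨
  F x + (H x + ∑ xs F + ∑ xs H)      ≡⟨ cong (λ m → F x + (m + ∑ xs H)) (+-comm (H x) (∑ xs F)) ⟩
  F x + (∑ xs F + H x + ∑ xs H)      ≡⟨ cong (F x +_) (+-assoc (∑ xs F) (H x) _) ⟩
  F x + (∑ xs F + (H x + ∑ xs H))    ≡⟨ +-assoc (F x) _ _ ⟨
  F x + ∑ xs F + (H x + ∑ xs H)      ∎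
  where open ≡-Reasoning

∑-comm : ∀ (xs : List A) (ys : List B) (F : A → B → ℕ) →
         ∑ xs (λ x → ∑ ys (F x)) ≡ ∑ ys (λ y → ∑ xs (λ x → F x y))
∑-comm []       ys F = begin
  0              ≡⟨ *-zeroʳ (length ys) ⟨
  length ys * 0  ≡⟨ ∑-const ys 0 ⟨
  ∑ ys (λ _ → 0) ∎
  where open ≡-Reasoning
∑-comm (x ∷ xs) ys F = begin
  ∑ ys (F x) + ∑ xs (λ x → ∑ ys (F x))         ≡⟨ cong (∑ ys (F x) +_) (∑-comm xs ys F) ⟩
  ∑ ys (F x) + ∑ ys (λ y → ∑ xs (λ x → F x y)) ≡⟨ ∑-+ ys (F x) _ ⟨
  ∑ ys (λ y → F x y + ∑ xs (λ x → F x y))      ∎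
  where open ≡-Reasoning

module _ (_≟_ : DecidableEquality B) where

  ∑-indicator-≡-∉ : ∀ {z} ys → z ∉ ys → ∑ ys (λ y → indicator (z ≟ y)) ≡ 0
  ∑-indicator-≡-∉         []       z∉ys = refl
  ∑-indicator-≡-∉ {z = z} (y ∷ ys) z∉ys with z ≟ y
  ... | yes z≡y = contradiction (here z≡y) z∉ys
  ... | no _    = ∑-indicator-≡-∉ ys (z∉ys ∘ there)

  ∑-indicator-≡-∈ : ∀ {z ys} → Unique ys → z ∈ ys → ∑ ys (λ y → indicator (z ≟ y)) ≡ 1
  ∑-indicator-≡-∈ {z} {y ∷ ys} (y∉ys ∷ _) (here refl) with z ≟ z
  ... | yes _  = cong suc (∑-indicator-≡-∉ ys λ z∈ys → All.lookup y∉ys z∈ys refl)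
  ... | no z≢z = contradiction refl z≢z
  ∑-indicator-≡-∈ {z} {y ∷ ys} (y∉ys ∷ ys!) (there z∈ys) with z ≟ y
  ... | yes refl = contradiction refl (All.lookup y∉ys z∈ys)
  ... | no _     = ∑-indicator-≡-∈ ys! z∈ys

  length-filter-∘≡∑-fibres :
    ∀ {P : Pred B p} (f : A → B) (P? : Decidable P) xs →
    length (filter (P? ∘ f) xs) ≡
    ∑ (filter P? (deduplicate _≟_ (map f xs))) (λ y → length (filter (λ x → f x ≟ y) xs))
  length-filter-∘≡∑-fibres f P? xs = begin
    length (filter (P? ∘ f) xs)                        ≡⟨ length-filter≡∑-indicator (P? ∘ f) xs ⟩
    ∑ xs (indicator ∘ P? ∘ f)                          ≡⟨ ∑-cong-∈ xs count-in-image ⟩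
    ∑ xs (λ x → ∑ image (λ y → indicator (f x ≟ y)))  ≡⟨ ∑-comm xs image _ ⟩
    ∑ image (λ y → ∑ xs (λ x → indicator (f x ≟ y)))  ≡⟨ ∑-cong-∈ image (λ {y} _ → length-filter≡∑-indicator (λ x → f x ≟ y) xs) ⟨
    ∑ image (λ y → length (filter (λ x → f x ≟ y) xs)) ∎
    where
    open ≡-Reasoning
    image = filter P? (deduplicate _≟_ (map f xs))

    image! : Unique image
    image! = UniqueProperties.filter⁺ P? (deduplicate-! _≟_ (map f xs))

    count-in-image : ∀ {x} → x ∈ xs → indicator (P? (f x)) ≡ ∑ image (λ y → indicator (f x ≟ y))
    count-in-image {x} x∈xs with P? (f x)
    ... | yes Pfx = sym (∑-indicator-≡-∈ image! (∈-filter⁺ P? (∈-deduplicate⁺ _≟_ (∈-map⁺ f x∈xs)) Pfx))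
    ... | no ¬Pfx = sym (∑-indicator-≡-∉ image (¬Pfx ∘ proj₂ ∘ ∈-filter⁻ P? {xs = deduplicate _≟_ (map f xs)}))

length-filter-map : ∀ {P : Pred B p} (P? : Decidable P) (f : A → B) xs →
                    length (filter P? (map f xs)) ≡ length (filter (P? ∘ f) xs)
length-filter-map P? f []       = refl
length-filter-map P? f (x ∷ xs) with P? (f x)
... | yes _ = cong suc (length-filter-map P? f xs)
... | no _  = length-filter-map P? f xs

module _ (S : Setoid a ℓ) where
  open Setoid S using (Carrier; _≈_) renaming (refl to ≈-refl; sym to ≈-sym; trans to ≈-trans)
  open SetoidMembership S using () renaming (_∈_ to _∈ₛ_)
  open SetoidMembershipProperties using (∈-resp-≈; All[≉]⇒∉; ∈-∃++)
  open SetoidUnique S using () renaming (Unique to Uniqueₛ)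
  open SetoidSubset S using (_⊆_)
  open SetoidPermutation S using (_↭_; prep; ↭-refl; ↭-sym; ↭-trans; ↭-reflexive-≋)
  open SetoidPermutationProperties S using (↭-shift; ∈-resp-↭; Unique-resp-↭; filter⁺; xs↭ys⇒|xs|≡|ys|)

  unique-⊆-⊇⇒↭ : ∀ {xs ys} → Uniqueₛ xs → Uniqueₛ ys → xs ⊆ ys → ys ⊆ xs → xs ↭ ys
  unique-⊆-⊇⇒↭ {[]}     {[]}     _ _ _ _     = ↭-refl
  unique-⊆-⊇⇒↭ {[]}     {y ∷ ys} _ _ _ ys⊆[] with () ← ys⊆[] (here ≈-refl)
  unique-⊆-⊇⇒↭ {x ∷ xs} {ys} (x≉xs ∷ xs!) ys! x∷xs⊆ys ys⊆x∷xs
    with as , bs , w , x≈w , ys≋ ← ∈-∃++ S (x∷xs⊆ys (here ≈-refl))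
    = ↭-trans (prep x≈w (unique-⊆-⊇⇒↭ xs! rest! xs⊆rest rest⊆xs)) (↭-sym ys↭w∷rest)
    where
    ys↭w∷rest : ys ↭ w ∷ as ++ bs
    ys↭w∷rest = ↭-trans (↭-reflexive-≋ ys≋) (↭-shift as bs)

    w∷rest! : Uniqueₛ (w ∷ as ++ bs)
    w∷rest! = Unique-resp-↭ ys↭w∷rest ys!

    rest! : Uniqueₛ (as ++ bs)
    rest! = AllPairs.tail w∷rest!

    xs⊆rest : xs ⊆ as ++ bs
    xs⊆rest z∈xs with ∈-resp-↭ ys↭w∷rest (x∷xs⊆ys (there z∈xs))
    ... | here z≈w     = contradiction (∈-resp-≈ S (≈-trans z≈w (≈-sym x≈w)) z∈xs) (All[≉]⇒∉ S x≉xs)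
    ... | there z∈rest = z∈rest

    rest⊆xs : as ++ bs ⊆ xs
    rest⊆xs z∈rest with ys⊆x∷xs (∈-resp-↭ (↭-sym ys↭w∷rest) (there z∈rest))
    ... | here z≈x   = contradiction (∈-resp-≈ S (≈-trans z≈x x≈w) z∈rest) (All[≉]⇒∉ S (AllPairs.head w∷rest!))
    ... | there z∈xs = z∈xs

  map-inverse⇒↭ : ∀ {φ ψ : Carrier → Carrier} {xs} →
                  Congruent _≈_ _≈_ φ → Congruent _≈_ _≈_ ψ →
                  (∀ x → ψ (φ x) ≈ x) → (∀ x → φ (ψ x) ≈ x) →
                  (∀ {x} → x ∈ₛ xs → φ x ∈ₛ xs) → (∀ {x} → x ∈ₛ xs → ψ x ∈ₛ xs) →
                  Uniqueₛ xs → map φ xs ↭ xs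
  map-inverse⇒↭ {φ} {ψ} {xs} φ-cong ψ-cong ψφ≈id φψ≈id φ-∈ ψ-∈ xs! =
    unique-⊆-⊇⇒↭ (SetoidUniqueProperties.map⁺ S S φ-injective xs!) xs! image⊆ ⊆image
    where
    φ-injective : ∀ {x y} → φ x ≈ φ y → x ≈ y
    φ-injective {x} {y} φx≈φy = ≈-trans (≈-sym (ψφ≈id x)) (≈-trans (ψ-cong φx≈φy) (ψφ≈id y))

    image⊆ : map φ xs ⊆ xs
    image⊆ z∈image with x , x∈xs , z≈φx ← SetoidMembershipProperties.∈-map⁻ S S z∈image =
      ∈-resp-≈ S (≈-sym z≈φx) (φ-∈ x∈xs)

    ⊆image : xs ⊆ map φ xs
    ⊆image {z} z∈xs = ∈-resp-≈ S (φψ≈id z) (SetoidMembershipProperties.∈-map⁺ S S φ-cong (ψ-∈ z∈xs))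

  length-filter-∘-invariant : ∀ {P : Pred Carrier p} (P? : Decidable P) → P Respects _≈_ →
                              ∀ {φ : Carrier → Carrier} {xs} → map φ xs ↭ xs →
                              length (filter (P? ∘ φ) xs) ≡ length (filter P? xs)
  length-filter-∘-invariant P? P-resp {φ} {xs} φxs↭xs =
    trans (sym (length-filter-map P? φ xs)) (xs↭ys⇒|xs|≡|ys| (filter⁺ P? P-resp φxs↭xs))

≈ₚ-setoid : ℕ → Setoid _ _
≈ₚ-setoid v = On.setoid (Fin v →-setoid Fin v) _⟨$⟩ʳ_

-- _≈ₚ_ unfolds to a Π-type, so Agda cannot infer the permutations it relates: below they are
-- often supplied by hand.
module _ {v : ℕ} where
  open SetoidMembership (≈ₚ-setoid v) using () renaming (_∈_ to _∈ₛ_)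
  open SetoidPermutation (≈ₚ-setoid v) using (_↭_)

  flip-cong : ∀ {g h : Permutation′ v} → g ≈ₚ h → flip g ≈ₚ flip h
  flip-cong {g} {h} g≈h i = begin
    g ⟨$⟩ˡ i                   ≡⟨ cong (g ⟨$⟩ˡ_) (inverseʳ h) ⟨
    g ⟨$⟩ˡ (h ⟨$⟩ʳ (h ⟨$⟩ˡ i)) ≡⟨ cong (g ⟨$⟩ˡ_) (g≈h (h ⟨$⟩ˡ i)) ⟨
    g ⟨$⟩ˡ (g ⟨$⟩ʳ (h ⟨$⟩ˡ i)) ≡⟨ inverseˡ g ⟩
    h ⟨$⟩ˡ i                   ∎
    where open ≡-Reasoning

  flip-involutive : ∀ (g : Permutation′ v) → flip (flip g) ≈ₚ g
  flip-involutive g i = refl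

  ∘ₚ-congˡ : ∀ {g g′ : Permutation′ v} h → g ≈ₚ g′ → (g ∘ₚ h) ≈ₚ (g′ ∘ₚ h)
  ∘ₚ-congˡ h g≈g′ i = cong (h ⟨$⟩ʳ_) (g≈g′ i)

  ∘ₚ-congʳ : ∀ g {h h′ : Permutation′ v} → h ≈ₚ h′ → (g ∘ₚ h) ≈ₚ (g ∘ₚ h′)
  ∘ₚ-congʳ g h≈h′ i = h≈h′ (g ⟨$⟩ʳ i)

  ∘ₚ-flip-cancelʳ : ∀ (g h : Permutation′ v) → ((g ∘ₚ h) ∘ₚ flip h) ≈ₚ g
  ∘ₚ-flip-cancelʳ g h i = inverseˡ h

  ∘ₚ-flip-cancelˡ : ∀ (g h : Permutation′ v) → ((g ∘ₚ flip h) ∘ₚ h) ≈ₚ g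
  ∘ₚ-flip-cancelˡ g h i = inverseʳ h

  module PermGroup {G : List (Permutation′ v)} (isG : IsPermGroup G) where
    open IsPermGroup isG

    ∈ₚ⇒∈ₛ : ∀ {g} → g ∈ₚ G → g ∈ₛ G
    ∈ₚ⇒∈ₛ = Any.map λ h≈g i → sym (h≈g i)

    ∈ₛ-resp-≈ₚ : ∀ {g h} → g ≈ₚ h → g ∈ₛ G → h ∈ₛ G
    ∈ₛ-resp-≈ₚ {g} {h} = SetoidMembershipProperties.∈-resp-≈ (≈ₚ-setoid v) {G} {g} {h}

    flip-∈ : ∀ {g} → g ∈ₛ G → flip g ∈ₛ G
    flip-∈ {g} = All.lookupₛ (≈ₚ-setoid v) {P = λ g → flip g ∈ₛ G} {xs = G}
      (λ {g} {h} g≈h → ∈ₛ-resp-≈ₚ {flip g} {flip h} (flip-cong {g} {h} g≈h))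
      (All.map (λ {g} → ∈ₚ⇒∈ₛ {flip g}) closed-⁻¹) {g}

    ∘ₚ-∈ : ∀ {g h} → g ∈ₛ G → h ∈ₛ G → g ∘ₚ h ∈ₛ G
    ∘ₚ-∈ {g} {h} g∈G = All.lookupₛ (≈ₚ-setoid v) {P = λ h → g ∘ₚ h ∈ₛ G} {xs = G}
      (λ {h} {h′} h≈h′ → ∈ₛ-resp-≈ₚ {g ∘ₚ h} {g ∘ₚ h′} (∘ₚ-congʳ g {h} {h′} h≈h′)) g∘G⊆G {h}
      where
      g∘G⊆G : All (λ h → g ∘ₚ h ∈ₛ G) G
      g∘G⊆G = All.lookupₛ (≈ₚ-setoid v) {P = λ g → All (λ h → g ∘ₚ h ∈ₛ G) G} {xs = G}
        (λ {g} {g′} g≈g′ → All.map (λ {h} → ∈ₛ-resp-≈ₚ {g ∘ₚ h} {g′ ∘ₚ h} (∘ₚ-congˡ {g} {g′} h g≈g′)))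
        (All.map (λ {g} → All.map (λ {h} → ∈ₚ⇒∈ₛ {g ∘ₚ h})) closed-∘) {g} g∈G

    map-flip-↭ : map flip G ↭ G
    map-flip-↭ = map-inverse⇒↭ (≈ₚ-setoid v) {φ = flip} {ψ = flip}
      (λ {g} {h} → flip-cong {g} {h}) (λ {g} {h} → flip-cong {g} {h}) flip-involutive flip-involutive
      (λ {g} → flip-∈ {g}) (λ {g} → flip-∈ {g}) distinct

    map-∘ₚ-↭ : ∀ {h} → h ∈ₛ G → map (_∘ₚ h) G ↭ G
    map-∘ₚ-↭ {h} h∈G = map-inverse⇒↭ (≈ₚ-setoid v) {φ = _∘ₚ h} {ψ = _∘ₚ flip h}
      (λ {g} {g′} → ∘ₚ-congˡ {g} {g′} h) (λ {g} {g′} → ∘ₚ-congˡ {g} {g′} (flip h))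
      (λ g → ∘ₚ-flip-cancelʳ g h) (λ g → ∘ₚ-flip-cancelˡ g h)
      (λ {g} g∈G → ∘ₚ-∈ {g} {h} g∈G h∈G) (λ {g} g∈G → ∘ₚ-∈ {g} {flip h} g∈G (flip-∈ {h} h∈G)) distinct

_≟ᵥ_ : ∀ {v t} → DecidableEquality (Vec (Fin v) t)
_≟ᵥ_ = ≡-dec _≟_

module _ {v t : ℕ} where

  act-cong : ∀ {g h : Permutation′ v} (s : Vec (Fin v) t) → g ≈ₚ h → act g s ≡ act h s
  act-cong s g≈h = map-cong g≈h s

  act-∘ₚ : ∀ (g h : Permutation′ v) (s : Vec (Fin v) t) → act (g ∘ₚ h) s ≡ act h (act g s)
  act-∘ₚ g h = map-∘ (h ⟨$⟩ʳ_) (g ⟨$⟩ʳ_)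

  act-flip-cancel : ∀ (g : Permutation′ v) (s : Vec (Fin v) t) → act (flip g) (act g s) ≡ s
  act-flip-cancel g s = begin
    act (flip g) (act g s) ≡⟨ act-∘ₚ g (flip g) s ⟨
    act (g ∘ₚ flip g) s    ≡⟨ map-cong (λ _ → inverseˡ g) s ⟩
    Vec.map (λ i → i) s    ≡⟨ map-id s ⟩
    s                      ∎
    where open ≡-Reasoning

  act-injective : ∀ (g : Permutation′ v) {s s′ : Vec (Fin v) t} → act g s ≡ act g s′ → s ≡ s′
  act-injective g {s} {s′} gs≡gs′ = begin
    s                       ≡⟨ act-flip-cancel g s ⟨
    act (flip g) (act g s)  ≡⟨ cong (act (flip g)) gs≡gs′ ⟩
    act (flip g) (act g s′) ≡⟨ act-flip-cancel g s′ ⟩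
    s′                      ∎
    where open ≡-Reasoning

module _ {v t : ℕ} {G : List (Permutation′ v)} (isG : IsPermGroup G) (s : Vec (Fin v) t) where
  open PermGroup isG

  -- covers? g s is definitionally increasing? (act (flip g) s).
  numCovering≡count-increasing : numCovering G s ≡ length (filter (λ g → increasing? (act g s)) G)
  numCovering≡count-increasing =
    length-filter-∘-invariant (≈ₚ-setoid v) (λ g → increasing? (act g s))
      (λ {g} {h} g≈h → subst Increasing (act-cong {g = g} {h} s g≈h)) map-flip-↭

  fibre≡stabiliser : ∀ {h} → h ∈ G →
                     length (filter (λ g → act g s ≟ᵥ act h s) G) ≡ length (Stab G s)
  fibre≡stabiliser {h} h∈G = begin
    length (filter (λ g → act g s ≟ᵥ act h s) G)
      ≡⟨ length-filter-∘-invariant (≈ₚ-setoid v) (λ g → act g s ≟ᵥ act h s)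
           (λ {g} {g′} g≈g′ → trans (sym (act-cong {g = g} {g′} s g≈g′))) (map-∘ₚ-↭ {h} h∈ₛG) ⟨
    length (filter (λ g → act (g ∘ₚ h) s ≟ᵥ act h s) G)
      ≡⟨ cong length (filter-≐ (λ g → act (g ∘ₚ h) s ≟ᵥ act h s) (λ g → act g s ≟ᵥ s) hs-fixed⇔s-fixed G) ⟩
    length (Stab G s) ∎
    where
    open ≡-Reasoning
    h∈ₛG : Any (h ≈ₚ_) G
    h∈ₛG = Any.map (λ { refl _ → refl }) h∈G

    hs-fixed⇔s-fixed : (λ g → act (g ∘ₚ h) s ≡ act h s) ≐ (λ g → act g s ≡ s)
    hs-fixed⇔s-fixed = (λ {g} ghs≡hs → act-injective h (trans (sym (act-∘ₚ g h s)) ghs≡hs))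
                     , (λ {g} gs≡s → trans (act-∘ₚ g h s) (cong (act h) gs≡s))

-- The distinctness of the entries of s is not needed.
lemma2p2 : (v t : ℕ) (G : List (Permutation′ v)) → IsPermGroup G →
           (s : SeqDistinct v t) →
           numCovering G (proj₁ s) ≡ length (Asc G (proj₁ s)) * length (Stab G (proj₁ s))
lemma2p2 v t G isG (s , _) = begin
  numCovering G s                                            ≡⟨ numCovering≡count-increasing isG s ⟩
  length (filter (λ g → increasing? (act g s)) G)            ≡⟨ length-filter-∘≡∑-fibres _≟ᵥ_ (λ g → act g s) increasing? G ⟩
  ∑ (Asc G s) (λ x → length (filter (λ g → act g s ≟ᵥ x) G)) ≡⟨ ∑-cong-∈ (Asc G s) fibre≡Stab ⟩
  ∑ (Asc G s) (λ _ → length (Stab G s))                      ≡⟨ ∑-const (Asc G s) _ ⟩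
  length (Asc G s) * length (Stab G s)                       ∎
  where
  open ≡-Reasoning
  fibre≡Stab : ∀ {x} → x ∈ Asc G s → length (filter (λ g → act g s ≟ᵥ x) G) ≡ length (Stab G s)
  fibre≡Stab x∈Asc
    with h , h∈G , refl ← ∈-map⁻ (λ g → act g s) (∈-deduplicate⁻ _≟ᵥ_ _ (proj₁ (∈-filter⁻ increasing? x∈Asc)))
    = fibre≡stabiliser isG s h∈G
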